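{- Let $m$ be a positive integer and $k,n$ integers. Then $$\left\lfloor\frac{4n+2k+2}m\right\rfloor-\left\lfloor\frac{2n+k+1}m\right\rfloor+2\left\lfloor \frac km\right\rfloor-2\left\lfloor\frac{2k}m\right\rfloor\ge\left\lfloor\frac nm\right\rfloor+\left\lfloor\frac{n-k+1}m\right\rfloor,$$ unless $m$ is even and $k\equiv n+1\equiv m/2 \pmod m$, in which case the right-hand side of this inequality equals the left-hand side plus one.
   Context: $\lfloor x\rfloor$ denotes the floor function. -}

module Defs where

open import Data.Nat using (ℕ; NonZero)
open import Data.Integer using (ℤ; +_; _/ℕ_)

-- ⌊ x / m ⌋ for an integer x and a positive natural m.
-- For positive divisors, Data.Integer's _/ℕ_ is Euclidean division,
-- which coincides with the floor of x / m.
⌊_/_⌋ : ℤ → (m : ℕ) .{{_ : NonZero m}} → ℤ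
⌊ x / m ⌋ = x /ℕ m

{-# OPTIONS --safe #-}
module Submission where

-- Replacing k by k + a m and n by n + b m shifts both sides by 2b - a, so we may take
-- 0 ≤ k, n < m. There ⌊k/m⌋ = ⌊n/m⌋ = 0, ⌊2k/m⌋ ∈ {0, 1}, ⌊(n - k + 1)/m⌋ ∈ {-1, 0, 1}, and
-- the first two terms on the left are ⌊2y/m⌋ - ⌊y/m⌋ for y = 2n + k + 1, which is at least j
-- as soon as (2j - 1) m ≤ 2y. Splitting on 2k < m and on n + 1 < k, these bounds suffice
-- except when m = 2k and n + 1 = k, where all six floors are determined exactly.

open import Defs
open import Data.Nat using (ℕ; NonZero)
open import Data.Integer using (ℤ; +_; _+_; _-_; _*_; _≤_; _%ℕ_)
open import Data.Product using (_×_; Σ; ∃)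
open import Relation.Binary.PropositionalEquality using (_≡_)
open import Relation.Nullary using (¬_)

open import Data.Integer using (-_; _<_; 0ℤ; +≤+; +<+; _≤?_; _<?_; NonNegative; nonNegative)
open import Data.Integer.DivMod using ([n/ℕd]*d≤n; n<s[n/ℕd]*d; a≡a%ℕn+[a/ℕn]*n; n%ℕd<d)
open import Data.Integer.Properties
open import Algebra.Properties.AbelianGroup +-0-abelianGroup using (∙-cancelʳ)
open import Algebra.Properties.CommutativeSemigroup +-commutativeSemigroup using (xy∙z≈xz∙y)
open import Data.Integer.Tactic.RingSolver using (solve; solve-∀)
open import Data.List using (_∷_; [])
open import Data.Nat using (zero; suc; z≤n)
import Data.Nat as ℕ
import Data.Nat.Properties as ℕ
open import Data.Product using (_,_)
open import Relation.Binary.PropositionalEquality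
  using (refl; sym; trans; subst; subst₂; cong; cong₂; module ≡-Reasoning)
open import Relation.Nullary using (yes; no; contradiction)

-- Linear inequalities are proved by exhibiting the slack as a visibly
-- nonnegative expression; the identity behind it is left to the ring solver.

j-[1+i]≡j-i-1 : ∀ i j → j - (+ 1 + i) ≡ j - i - + 1
j-[1+i]≡j-i-1 = solve-∀

≤-by-slack : ∀ {i j} d → 0ℤ ≤ d → j - i ≡ d → i ≤ j
≤-by-slack d 0≤d j-i≡d = 0≤i-j⇒j≤i (subst (0ℤ ≤_) (sym j-i≡d) 0≤d)

<-by-slack : ∀ {i j} d → 0ℤ ≤ d → j - i - + 1 ≡ d → i < j
<-by-slack {i} {j} d 0≤d j-i-1≡d =
  suc[i]≤j⇒i<j (≤-by-slack d 0≤d (trans (j-[1+i]≡j-i-1 i j) j-i-1≡d))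

i<j⇒0≤j-i-1 : ∀ {i j} → i < j → 0ℤ ≤ j - i - + 1
i<j⇒0≤j-i-1 {i} {j} i<j = subst (0ℤ ≤_) (j-[1+i]≡j-i-1 i j) (i≤j⇒0≤j-i (i<j⇒suc[i]≤j i<j))

0≤+ : ∀ {i j} → 0ℤ ≤ i → 0ℤ ≤ j → 0ℤ ≤ i + j
0≤+ = +-mono-≤

0≤* : ∀ n {i} → 0ℤ ≤ i → 0ℤ ≤ + n * i
0≤* n 0≤i = subst (_≤ + n * _) (*-zeroʳ (+ n)) (*-monoˡ-≤-nonNeg (+ n) 0≤i)

0≤1 : 0ℤ ≤ + 1
0≤1 = +≤+ z≤n

record IsFloor (x M q : ℤ) : Set where
  field
    lower : q * M ≤ x
    upper : x < (q + + 1) * M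

i<j+1⇒i≤j : ∀ {i j} → i < j + + 1 → i ≤ j
i<j+1⇒i≤j {i} {j} i<j+1 = subst (i ≤_) pred[j+1]≡j (i<j⇒i≤pred[j] i<j+1)
  where
  pred[j+1]≡j : - + 1 + (j + + 1) ≡ j
  pred[j+1]≡j = solve (j ∷ [])

module _ {x M q : ℤ} .{{_ : NonNegative M}} (f : IsFloor x M q) where
  open IsFloor f

  isFloor-greatest : ∀ {p} → p * M ≤ x → p ≤ q
  isFloor-greatest pM≤x = i<j+1⇒i≤j (*-cancelʳ-<-nonNeg M (≤-<-trans pM≤x upper))

  isFloor-least : ∀ {p} → x < (p + + 1) * M → q ≤ p
  isFloor-least x<[p+1]M = i<j+1⇒i≤j (*-cancelʳ-<-nonNeg M (≤-<-trans lower x<[p+1]M))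

  isFloor-unique : ∀ {q′} → IsFloor x M q′ → q ≡ q′
  isFloor-unique f′ =
    ≤-antisym (isFloor-least (IsFloor.upper f′)) (isFloor-greatest (IsFloor.lower f′))

isFloor-shift : ∀ {x M q} c → IsFloor x M q → IsFloor (x + c * M) M (q + c)
isFloor-shift {x} {M} {q} c f = record
  { lower = ≤-by-slack (x - q * M) (i≤j⇒0≤j-i lower) (solve (x ∷ M ∷ q ∷ c ∷ []))
  ; upper = <-by-slack ((q + + 1) * M - x - + 1) (i<j⇒0≤j-i-1 upper) (solve (x ∷ M ∷ q ∷ c ∷ []))
  }
  where open IsFloor f

-- Hermite's identity ⌊2x⌋ - ⌊x⌋ = ⌊x + 1/2⌋, used as a lower bound.
isFloor-double : ∀ {y M q q′} .{{_ : NonNegative M}} → IsFloor y M q → IsFloor (+ 2 * y) M q′ →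
                 ∀ j → (+ 2 * j - + 1) * M ≤ + 2 * y → j ≤ q′ - q
isFloor-double {y} {M} {q} {q′} f f₂ j [2j-1]M≤2y with j ≤? q
... | yes j≤q = ≤-by-slack ((q′ - + 2 * q) + (q - j))
                  (0≤+ (i≤j⇒0≤j-i 2q≤q′) (i≤j⇒0≤j-i j≤q)) (solve (q ∷ q′ ∷ j ∷ []))
  where
  2q≤q′ : + 2 * q ≤ q′
  2q≤q′ = isFloor-greatest f₂ 2qM≤2y
    where
    2qM≤2y : + 2 * q * M ≤ + 2 * y
    2qM≤2y = ≤-by-slack (+ 2 * (y - q * M)) (0≤* 2 (i≤j⇒0≤j-i (IsFloor.lower f)))
                        (solve (y ∷ M ∷ q ∷ []))
... | no j≰q = ≤-by-slack (q′ - (q + j)) (i≤j⇒0≤j-i q+j≤q′) (solve (q ∷ q′ ∷ j ∷ []))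
  where
  q+j≤q′ : q + j ≤ q′
  q+j≤q′ = isFloor-greatest f₂ [q+j]M≤2y
    where
    [q+j]M≤2y : (q + j) * M ≤ + 2 * y
    [q+j]M≤2y = ≤-by-slack ((+ 2 * y - (+ 2 * j - + 1) * M) + (j - q - + 1) * M)
      (0≤+ (i≤j⇒0≤j-i [2j-1]M≤2y) (*-monoʳ-≤-nonNeg M (i<j⇒0≤j-i-1 (≰⇒> j≰q))))
      (solve (y ∷ M ∷ q ∷ j ∷ []))

-- r and s stand for k and n reduced modulo M.
module Residue {M r s A B C D : ℤ} (0≤r : 0ℤ ≤ r) (r<M : r < M) (0≤s : 0ℤ ≤ s) (s<M : s < M)
  (fA : IsFloor (+ 4 * s + + 2 * r + + 2) M A) (fB : IsFloor (+ 2 * s + r + + 1) M B)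
  (fC : IsFloor (+ 2 * r) M C) (fD : IsFloor (s - r + + 1) M D) where

  private
    0<M : 0ℤ < M
    0<M = ≤-<-trans 0≤s s<M

    instance
      M-nonNeg : NonNegative M
      M-nonNeg = nonNegative (<⇒≤ 0<M)

    0≤M : 0ℤ ≤ M
    0≤M = <⇒≤ 0<M

  A-B-lower : ∀ j → (+ 2 * j - + 1) * M ≤ + 2 * (+ 2 * s + r + + 1) → j ≤ A - B
  A-B-lower = isFloor-double fB (subst (λ x → IsFloor x M A) 4s+2r+2≡2[2s+r+1] fA)
    where
    4s+2r+2≡2[2s+r+1] : + 4 * s + + 2 * r + + 2 ≡ + 2 * (+ 2 * s + r + + 1)
    4s+2r+2≡2[2s+r+1] = solve (r ∷ s ∷ [])

  0<r : M ≤ + 2 * r → 0ℤ < r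
  0<r M≤2r = *-cancelˡ-<-nonNeg (+ 2) (<-≤-trans 0<M M≤2r)

  C≤0 : + 2 * r < M → C ≤ 0ℤ
  C≤0 2r<M = isFloor-least fC
    (<-by-slack (M - + 2 * r - + 1) (i<j⇒0≤j-i-1 2r<M) (solve (M ∷ r ∷ [])))

  C≤1 : C ≤ + 1
  C≤1 = isFloor-least fC (<-by-slack (+ 2 * (M - r - + 1) + + 1) (0≤+ (0≤* 2 (i<j⇒0≤j-i-1 r<M)) 0≤1)
                            (solve (M ∷ r ∷ [])))

  C≥1 : M ≤ + 2 * r → + 1 ≤ C
  C≥1 M≤2r = isFloor-greatest fC
    (≤-by-slack (+ 2 * r - M) (i≤j⇒0≤j-i M≤2r) (solve (M ∷ r ∷ [])))

  D≤A-B : D ≤ A - B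
  D≤A-B = A-B-lower D (≤-by-slack (+ 2 * (s - r + + 1 - D * M) + M + + 2 * s + + 4 * r)
            (0≤+ (0≤+ (0≤+ (0≤* 2 (i≤j⇒0≤j-i (IsFloor.lower fD))) 0≤M) (0≤* 2 0≤s)) (0≤* 4 0≤r))
            (solve (M ∷ r ∷ s ∷ D ∷ [])))

  A-B≥1 : M ≤ + 2 * r → + 1 ≤ A - B
  A-B≥1 M≤2r = A-B-lower (+ 1) (≤-by-slack ((+ 2 * r - M) + + 4 * s + + 2)
                 (0≤+ (0≤+ (i≤j⇒0≤j-i M≤2r) (0≤* 4 0≤s)) (0≤* 2 0≤1)) (solve (M ∷ r ∷ s ∷ [])))

  D≤-1 : s + + 1 < r → D ≤ - + 1
  D≤-1 s+1<r = isFloor-least fD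
    (<-by-slack (r - (s + + 1) - + 1) (i<j⇒0≤j-i-1 s+1<r) (solve (M ∷ r ∷ s ∷ [])))

  D≤0 : M ≤ + 2 * r → D ≤ 0ℤ
  D≤0 M≤2r = isFloor-least fD (<-by-slack ((M - s - + 1) + (r - 0ℤ - + 1))
               (0≤+ (i<j⇒0≤j-i-1 s<M) (i<j⇒0≤j-i-1 (0<r M≤2r))) (solve (M ∷ r ∷ s ∷ [])))

  D≥0 : r ≤ s + + 1 → 0ℤ ≤ D
  D≥0 r≤s+1 = isFloor-greatest fD
    (≤-by-slack (s + + 1 - r) (i≤j⇒0≤j-i r≤s+1) (solve (M ∷ r ∷ s ∷ [])))

  A-B≥2 : M ≤ + 2 * r → r ≤ s + + 1 → ¬ (M ≡ + 2 * r × s + + 1 ≡ r) → + 2 ≤ A - B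
  A-B≥2 M≤2r r≤s+1 not-exceptional with M <? + 2 * r
  ... | yes M<2r = A-B-lower (+ 2) (≤-by-slack (+ 3 * (+ 2 * r - M - + 1) + + 4 * (s + + 1 - r) + + 1)
          (0≤+ (0≤+ (0≤* 3 (i<j⇒0≤j-i-1 M<2r)) (0≤* 4 (i≤j⇒0≤j-i r≤s+1))) 0≤1)
          (solve (M ∷ r ∷ s ∷ [])))
  ... | no M≮2r = A-B-lower (+ 2) (≤-by-slack (+ 3 * (+ 2 * r - M) + + 4 * (s + + 1 - r - + 1) + + 2)
          (0≤+ (0≤+ (0≤* 3 (i≤j⇒0≤j-i M≤2r)) (0≤* 4 (i<j⇒0≤j-i-1 r<s+1))) (0≤* 2 0≤1))
          (solve (M ∷ r ∷ s ∷ [])))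
    where
    M≡2r : M ≡ + 2 * r
    M≡2r = ≤-antisym M≤2r (≮⇒≥ M≮2r)
    r<s+1 : r < s + + 1
    r<s+1 = ≤∧≢⇒< r≤s+1 (λ r≡s+1 → not-exceptional (M≡2r , sym r≡s+1))

  A≤2 : M ≡ + 2 * r → s + + 1 ≡ r → A ≤ + 2
  A≤2 M≡2r s+1≡r = isFloor-least fA (<-by-slack (+ 3 * (M - + 2 * r) + + 4 * (r - (s + + 1)) + + 1)
    (0≤+ (0≤+ (0≤* 3 (i≤j⇒0≤j-i (≤-reflexive (sym M≡2r)))) (0≤* 4 (i≤j⇒0≤j-i (≤-reflexive s+1≡r)))) 0≤1)
    (solve (M ∷ r ∷ s ∷ [])))

  B≥1 : M ≤ + 2 * r → r ≤ s + + 1 → + 1 ≤ B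
  B≥1 M≤2r r≤s+1 = isFloor-greatest fB (≤-by-slack (+ 2 * (s + + 1 - r) + (+ 2 * r - M) + (r - 0ℤ - + 1))
    (0≤+ (0≤+ (0≤* 2 (i≤j⇒0≤j-i r≤s+1)) (i≤j⇒0≤j-i M≤2r)) (i<j⇒0≤j-i-1 (0<r M≤2r)))
    (solve (M ∷ r ∷ s ∷ [])))

  excess-nonneg-2r<M : + 2 * r < M → D ≤ A - B - + 2 * C
  excess-nonneg-2r<M 2r<M = ≤-by-slack ((A - B - D) + + 2 * (0ℤ - C))
    (0≤+ (i≤j⇒0≤j-i D≤A-B) (0≤* 2 (i≤j⇒0≤j-i (C≤0 2r<M)))) (solve (A ∷ B ∷ C ∷ D ∷ []))

  excess-nonneg-s+1<r : M ≤ + 2 * r → s + + 1 < r → D ≤ A - B - + 2 * C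
  excess-nonneg-s+1<r M≤2r s+1<r = ≤-by-slack ((A - B - + 1) + + 2 * (+ 1 - C) + (- + 1 - D))
    (0≤+ (0≤+ (i≤j⇒0≤j-i (A-B≥1 M≤2r)) (0≤* 2 (i≤j⇒0≤j-i C≤1))) (i≤j⇒0≤j-i (D≤-1 s+1<r)))
    (solve (A ∷ B ∷ C ∷ D ∷ []))

  excess-nonneg-r≤s+1 : M ≤ + 2 * r → r ≤ s + + 1 → ¬ (M ≡ + 2 * r × s + + 1 ≡ r) → D ≤ A - B - + 2 * C
  excess-nonneg-r≤s+1 M≤2r r≤s+1 not-exceptional = ≤-by-slack ((A - B - + 2) + + 2 * (+ 1 - C) + (0ℤ - D))
    (0≤+ (0≤+ (i≤j⇒0≤j-i (A-B≥2 M≤2r r≤s+1 not-exceptional)) (0≤* 2 (i≤j⇒0≤j-i C≤1)))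
         (i≤j⇒0≤j-i (D≤0 M≤2r)))
    (solve (A ∷ B ∷ C ∷ D ∷ []))

  excess-nonneg : ¬ (M ≡ + 2 * r × s + + 1 ≡ r) → D ≤ A - B - + 2 * C
  excess-nonneg not-exceptional with + 2 * r <? M | s + + 1 <? r
  ... | yes 2r<M | _        = excess-nonneg-2r<M 2r<M
  ... | no 2r≮M  | yes s+1<r = excess-nonneg-s+1<r (≮⇒≥ 2r≮M) s+1<r
  ... | no 2r≮M  | no s+1≮r  = excess-nonneg-r≤s+1 (≮⇒≥ 2r≮M) (≮⇒≥ s+1≮r) not-exceptional

  excess-exceptional : M ≡ + 2 * r → s + + 1 ≡ r → D ≡ A - B - + 2 * C + + 1
  excess-exceptional M≡2r s+1≡r = ≤-antisym D≤excess+1 excess+1≤D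
    where
    M≤2r : M ≤ + 2 * r
    M≤2r = ≤-reflexive M≡2r
    r≤s+1 : r ≤ s + + 1
    r≤s+1 = ≤-reflexive (sym s+1≡r)
    D≤excess+1 : D ≤ A - B - + 2 * C + + 1
    D≤excess+1 = ≤-by-slack ((A - B - + 1) + + 2 * (+ 1 - C) + (0ℤ - D))
      (0≤+ (0≤+ (i≤j⇒0≤j-i (A-B≥1 M≤2r)) (0≤* 2 (i≤j⇒0≤j-i C≤1))) (i≤j⇒0≤j-i (D≤0 M≤2r)))
      (solve (A ∷ B ∷ C ∷ D ∷ []))
    excess+1≤D : A - B - + 2 * C + + 1 ≤ D
    excess+1≤D = ≤-by-slack ((D - 0ℤ) + (+ 2 - A) + (B - + 1) + + 2 * (C - + 1))
      (0≤+ (0≤+ (0≤+ (i≤j⇒0≤j-i (D≥0 r≤s+1)) (i≤j⇒0≤j-i (A≤2 M≡2r s+1≡r))) (i≤j⇒0≤j-i (B≥1 M≤2r r≤s+1)))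
           (0≤* 2 (i≤j⇒0≤j-i (C≥1 M≤2r))))
      (solve (A ∷ B ∷ C ∷ D ∷ []))

module FloorDiv (m : ℕ) .{{_ : NonZero m}} where

  ⌊⌋-isFloor : ∀ x → IsFloor x (+ m) ⌊ x / m ⌋
  ⌊⌋-isFloor x = record
    { lower = [n/ℕd]*d≤n x m
    ; upper = subst (λ q → x < q * + m) (+-comm (+ 1) ⌊ x / m ⌋) (n<s[n/ℕd]*d x m)
    }

  ⌊⌋-unique : ∀ {x q} → IsFloor x (+ m) q → ⌊ x / m ⌋ ≡ q
  ⌊⌋-unique = isFloor-unique (⌊⌋-isFloor _)

  ⌊⌋≡0 : ∀ {x} → 0ℤ ≤ x → x < + m → ⌊ x / m ⌋ ≡ 0ℤ
  ⌊⌋≡0 {x} 0≤x x<m =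
    ⌊⌋-unique (record { lower = 0≤x ; upper = subst (x <_) (sym (*-identityˡ (+ m))) x<m })

  ⌊⌋-shift : ∀ x c {y} → y ≡ x + c * + m → ⌊ y / m ⌋ ≡ ⌊ x / m ⌋ + c
  ⌊⌋-shift x c refl = ⌊⌋-unique (isFloor-shift c (⌊⌋-isFloor x))

  lhs rhs : ℤ → ℤ → ℤ
  lhs k n = ⌊ + 4 * n + + 2 * k + + 2 / m ⌋ - ⌊ + 2 * n + k + + 1 / m ⌋
            + + 2 * ⌊ k / m ⌋ - + 2 * ⌊ + 2 * k / m ⌋
  rhs k n = ⌊ n / m ⌋ + ⌊ n - k + + 1 / m ⌋

  -- The ring solver only accepts variables, so the identities below abstract the modulus as M.
  lhs-periodic : ∀ k n a b → lhs (k + a * + m) (n + b * + m) ≡ lhs k n + (+ 2 * b - a)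
  lhs-periodic k n a b = trans
    (cong₂ _-_
      (cong₂ _+_
        (cong₂ _-_ (⌊⌋-shift (+ 4 * n + + 2 * k + + 2) (+ 4 * b + + 2 * a) (shift-4n+2k+2 (+ m)))
                   (⌊⌋-shift (+ 2 * n + k + + 1) (+ 2 * b + a) (shift-2n+k+1 (+ m))))
        (cong (+ 2 *_) (⌊⌋-shift k a refl)))
      (cong (+ 2 *_) (⌊⌋-shift (+ 2 * k) (+ 2 * a) (shift-2k (+ m)))))
    (regroup ⌊ + 4 * n + + 2 * k + + 2 / m ⌋ ⌊ + 2 * n + k + + 1 / m ⌋ ⌊ k / m ⌋ ⌊ + 2 * k / m ⌋)
    where
    shift-4n+2k+2 : ∀ M → + 4 * (n + b * M) + + 2 * (k + a * M) + + 2
                          ≡ + 4 * n + + 2 * k + + 2 + (+ 4 * b + + 2 * a) * M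
    shift-4n+2k+2 M = solve (M ∷ k ∷ n ∷ a ∷ b ∷ [])
    shift-2n+k+1 : ∀ M → + 2 * (n + b * M) + (k + a * M) + + 1 ≡ + 2 * n + k + + 1 + (+ 2 * b + a) * M
    shift-2n+k+1 M = solve (M ∷ k ∷ n ∷ a ∷ b ∷ [])
    shift-2k : ∀ M → + 2 * (k + a * M) ≡ + 2 * k + + 2 * a * M
    shift-2k M = solve (M ∷ k ∷ a ∷ [])
    regroup : ∀ A B K C →
      A + (+ 4 * b + + 2 * a) - (B + (+ 2 * b + a)) + + 2 * (K + a) - + 2 * (C + + 2 * a)
        ≡ A - B + + 2 * K - + 2 * C + (+ 2 * b - a)
    regroup A B K C = solve (A ∷ B ∷ K ∷ C ∷ a ∷ b ∷ [])

  rhs-periodic : ∀ k n a b → rhs (k + a * + m) (n + b * + m) ≡ rhs k n + (+ 2 * b - a)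
  rhs-periodic k n a b
    = trans (cong₂ _+_ (⌊⌋-shift n b refl) (⌊⌋-shift (n - k + + 1) (b - a) (shift-n-k+1 (+ m))))
            (regroup ⌊ n / m ⌋ ⌊ n - k + + 1 / m ⌋)
    where
    shift-n-k+1 : ∀ M → n + b * M - (k + a * M) + + 1 ≡ n - k + + 1 + (b - a) * M
    shift-n-k+1 M = solve (M ∷ k ∷ n ∷ a ∷ b ∷ [])
    regroup : ∀ N D → N + b + (D + (b - a)) ≡ N + D + (+ 2 * b - a)
    regroup N D = solve (N ∷ D ∷ a ∷ b ∷ [])

  module _ {r s : ℤ} (0≤r : 0ℤ ≤ r) (r<m : r < + m) (0≤s : 0ℤ ≤ s) (s<m : s < + m) where
    open Residue 0≤r r<m 0≤s s<m (⌊⌋-isFloor _) (⌊⌋-isFloor _) (⌊⌋-isFloor _) (⌊⌋-isFloor _)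

    private
      A B C D : ℤ
      A = ⌊ + 4 * s + + 2 * r + + 2 / m ⌋
      B = ⌊ + 2 * s + r + + 1 / m ⌋
      C = ⌊ + 2 * r / m ⌋
      D = ⌊ s - r + + 1 / m ⌋

      lhs-residue : lhs r s ≡ A - B - + 2 * C
      lhs-residue = trans (cong (λ R → A - B + + 2 * R - + 2 * C) (⌊⌋≡0 0≤r r<m))
                          (cong (_- + 2 * C) (+-identityʳ (A - B)))

      rhs-residue : rhs r s ≡ D
      rhs-residue = trans (cong (_+ D) (⌊⌋≡0 0≤s s<m)) (+-identityˡ D)

    rhs≤lhs-residue : ¬ (+ m ≡ + 2 * r × s + + 1 ≡ r) → rhs r s ≤ lhs r s
    rhs≤lhs-residue not-exceptional =
      subst₂ _≤_ (sym rhs-residue) (sym lhs-residue) (excess-nonneg not-exceptional)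

    rhs≡lhs+1-residue : + m ≡ + 2 * r → s + + 1 ≡ r → rhs r s ≡ lhs r s + + 1
    rhs≡lhs+1-residue M≡2r s+1≡r =
      subst₂ _≡_ (sym rhs-residue) (cong (_+ + 1) (sym lhs-residue)) (excess-exceptional M≡2r s+1≡r)

  %ℕ-unique : ∀ {y q ρ} → ρ ℕ.< m → y ≡ + ρ + q * + m → y %ℕ m ≡ ρ
  %ℕ-unique {y} {q} {ρ} ρ<m y≡ρ+qm = +-injective (∙-cancelʳ (q * + m) (+ (y %ℕ m)) (+ ρ) (begin
    + (y %ℕ m) + q * + m          ≡⟨ cong (λ q′ → + (y %ℕ m) + q′ * + m) ⌊y⌋≡q ⟨
    + (y %ℕ m) + ⌊ y / m ⌋ * + m  ≡⟨ a≡a%ℕn+[a/ℕn]*n y m ⟨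
    y                              ≡⟨ y≡ρ+qm ⟩
    + ρ + q * + m                  ∎))
    where
    open ≡-Reasoning
    ⌊y⌋≡q : ⌊ y / m ⌋ ≡ q
    ⌊y⌋≡q = trans (⌊⌋-shift (+ ρ) q y≡ρ+qm)
                  (trans (cong (_+ q) (⌊⌋≡0 (+≤+ z≤n) (+<+ ρ<m))) (+-identityˡ q))

  Exceptional : ℤ → ℤ → Set
  Exceptional k n = Σ ℕ (λ h → (m ≡ 2 ℕ.* h) × (k %ℕ m ≡ h) × ((n + + 1) %ℕ m ≡ h))

  rhs≤lhs : ∀ k n → ¬ Exceptional k n → rhs k n ≤ lhs k n
  rhs≤lhs k n not-exceptional = begin
    rhs k n                   ≡⟨ cong₂ rhs k≡r+am n≡s+bm ⟩
    rhs (r + a * + m) (s + b * + m) ≡⟨ rhs-periodic r s a b ⟩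
    rhs r s + (+ 2 * b - a)   ≤⟨ +-monoˡ-≤ _ (rhs≤lhs-residue 0≤r r<m 0≤s s<m not-exceptional′) ⟩
    lhs r s + (+ 2 * b - a)   ≡⟨ lhs-periodic r s a b ⟨
    lhs (r + a * + m) (s + b * + m) ≡⟨ cong₂ lhs k≡r+am n≡s+bm ⟨
    lhs k n                   ∎
    where
    open ≤-Reasoning
    r s a b : ℤ
    r = + (k %ℕ m)
    s = + (n %ℕ m)
    a = ⌊ k / m ⌋
    b = ⌊ n / m ⌋
    k≡r+am : k ≡ r + a * + m
    k≡r+am = a≡a%ℕn+[a/ℕn]*n k m
    n≡s+bm : n ≡ s + b * + m
    n≡s+bm = a≡a%ℕn+[a/ℕn]*n n m
    0≤r : 0ℤ ≤ r
    0≤r = +≤+ z≤n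
    0≤s : 0ℤ ≤ s
    0≤s = +≤+ z≤n
    r<m : r < + m
    r<m = +<+ (n%ℕd<d k m)
    s<m : s < + m
    s<m = +<+ (n%ℕd<d n m)
    not-exceptional′ : ¬ (+ m ≡ + 2 * r × s + + 1 ≡ r)
    not-exceptional′ (m≡2r , s+1≡r) = not-exceptional
      (k %ℕ m , +-injective (trans m≡2r (sym (pos-* 2 (k %ℕ m)))) , refl ,
       %ℕ-unique {q = b} (n%ℕd<d k m) n+1≡r+bm)
      where
      n+1≡r+bm : n + + 1 ≡ r + b * + m
      n+1≡r+bm = begin-equality
        n + + 1            ≡⟨ cong (_+ + 1) n≡s+bm ⟩
        s + b * + m + + 1  ≡⟨ xy∙z≈xz∙y s (b * + m) (+ 1) ⟩
        s + + 1 + b * + m  ≡⟨ cong (_+ b * + m) s+1≡r ⟩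
        r + b * + m        ∎

  rhs≡lhs+1 : ∀ k n → Exceptional k n → rhs k n ≡ lhs k n + + 1
  rhs≡lhs+1 k n (zero , m≡0 , _) = contradiction m≡0 (ℕ.≢-nonZero⁻¹ m)
  rhs≡lhs+1 k n (suc h , m≡2h , k%m≡h , [n+1]%m≡h) = begin
    rhs k n                             ≡⟨ cong₂ rhs k≡r+am n≡s+bm ⟩
    rhs (r + a * + m) (s + b * + m)     ≡⟨ rhs-periodic r s a b ⟩
    rhs r s + (+ 2 * b - a)
      ≡⟨ cong (_+ (+ 2 * b - a)) (rhs≡lhs+1-residue 0≤r r<m 0≤s s<m m≡2r s+1≡r) ⟩
    lhs r s + + 1 + (+ 2 * b - a)       ≡⟨ xy∙z≈xz∙y (lhs r s) (+ 1) (+ 2 * b - a) ⟩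
    lhs r s + (+ 2 * b - a) + + 1       ≡⟨ cong (_+ + 1) (lhs-periodic r s a b) ⟨
    lhs (r + a * + m) (s + b * + m) + + 1 ≡⟨ cong (_+ + 1) (cong₂ lhs k≡r+am n≡s+bm) ⟨
    lhs k n + + 1                       ∎
    where
    open ≡-Reasoning
    r s a b : ℤ
    r = + suc h
    s = + h
    a = ⌊ k / m ⌋
    b = ⌊ n + + 1 / m ⌋
    k≡r+am : k ≡ r + a * + m
    k≡r+am = trans (a≡a%ℕn+[a/ℕn]*n k m) (cong (λ ρ → + ρ + a * + m) k%m≡h)
    n≡s+bm : n ≡ s + b * + m
    n≡s+bm = ∙-cancelʳ (+ 1) n (s + b * + m) (begin
      n + + 1                            ≡⟨ a≡a%ℕn+[a/ℕn]*n (n + + 1) m ⟩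
      + ((n + + 1) %ℕ m) + b * + m       ≡⟨ cong (λ ρ → + ρ + b * + m) [n+1]%m≡h ⟩
      + 1 + s + b * + m                  ≡⟨ cong (_+ b * + m) (+-comm (+ 1) s) ⟩
      s + + 1 + b * + m                  ≡⟨ xy∙z≈xz∙y s (+ 1) (b * + m) ⟩
      s + b * + m + + 1                  ∎)
    0≤r : 0ℤ ≤ r
    0≤r = +≤+ z≤n
    0≤s : 0ℤ ≤ s
    0≤s = +≤+ z≤n
    r<m : r < + m
    r<m = +<+ (subst (suc h ℕ.<_) (sym m≡2h) (ℕ.m<m+n (suc h) ℕ.z<s))
    s<m : s < + m
    s<m = <-trans (+<+ (ℕ.n<1+n h)) r<m
    m≡2r : + m ≡ + 2 * r
    m≡2r = trans (cong +_ m≡2h) (pos-* 2 (suc h))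
    s+1≡r : s + + 1 ≡ r
    s+1≡r = +-comm s (+ 1)

theorem2p2 : (m : ℕ) .{{_ : NonZero m}} (k n : ℤ) →
  let LHS = ⌊ + 4 * n + + 2 * k + + 2 / m ⌋ - ⌊ + 2 * n + k + + 1 / m ⌋
            + + 2 * ⌊ k / m ⌋ - + 2 * ⌊ + 2 * k / m ⌋
      RHS = ⌊ n / m ⌋ + ⌊ n - k + + 1 / m ⌋
      Exc = Σ ℕ (λ h → (m ≡ 2 Data.Nat.* h) × (k %ℕ m ≡ h) × ((n + + 1) %ℕ m ≡ h))
  in (¬ Exc → RHS ≤ LHS) × (Exc → RHS ≡ LHS + + 1)
theorem2p2 m k n = rhs≤lhs k n , rhs≡lhs+1 k n
  where open FloorDiv m
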